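{- Let $f\colon A^*\to A^*$ be a Parikh-collinear morphism prolongable on $a\in A$, let $\mathbf{x}=f^{\omega}(a)$ and let $k=\sum_{b\in A}|f(b)|_b$ be the eigenvalue of $f$. Then for every $b\in A$, the sequence $(|\mathrm{pref}_n(\mathbf{x})|_b)_{n\ge0}$ is $k$-synchronized.
   Context: A morphism is Parikh-collinear if the Parikh vectors (vectors of letter counts) of the images of letters are pairwise $\mathbb{Z}$-linearly dependent; it may be erasing. $f$ is prolongable on $a$ if $f(a)=au$ and $|f^n(a)|\to\infty$; $f^{\omega}(a)=\lim_n f^n(a)$. $\mathrm{pref}_n(\mathbf{x})$ is the length-$n$ prefix of $\mathbf{x}$ and $|w|_b$ the number of occurrences of $b$ in $w$. A sequence $(s(n))_{n\ge0}$ of natural numbers is $k$-synchronized if the set of pairs $(n,s(n))$, written in base $k$ (most significant digit first, shorter representation padded with leading zeros, read in parallel), is accepted by a finite automaton. -}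

module Defs where

open import Data.Nat using (ℕ; zero; suc; _+_; _*_; _≤_)
open import Data.Integer as ℤ using (ℤ; +_)
open import Data.Fin using (Fin; toℕ) renaming (zero to fzero)
open import Data.Fin.Properties using (_≟_)
open import Data.List using (List; []; _∷_; length; filter; map; upTo; take; concatMap; foldl; allFin)
open import Data.Nat.ListAction using (sum)
open import Data.Product using (Σ; ∃; _×_; _,_; proj₁; proj₂)
open import Data.Bool using (Bool; true)
open import Relation.Binary.PropositionalEquality using (_≡_)
open import Relation.Nullary using (¬_)
open import Data.Unit using (⊤)

-- Alphabet A = Fin m ; words are lists ; infinite words are streams ℕ → Fin m.
Word : ℕ → Set
Word m = List (Fin m)

-- A morphism A* → A* is determined by the images of the letters (possibly erasing).
Morph : ℕ → Set
Morph m = Fin m → Word m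

apply : ∀ {m} → Morph m → Word m → Word m
apply f w = concatMap f w

iter : ∀ {m} → Morph m → ℕ → Word m → Word m
iter f zero    w = w
iter f (suc n) w = apply f (iter f n w)

count : ∀ {m} → Fin m → Word m → ℕ
count b w = length (filter (_≟ b) w)

ParikhCollinear : ∀ {m} → Morph m → Set
ParikhCollinear {m} f =
  (b c : Fin m) → Σ ℤ λ p → Σ ℤ λ q →
    ¬ (p ≡ + 0 × q ≡ + 0) ×
    ((d : Fin m) → p ℤ.* (+ count d (f b)) ℤ.+ q ℤ.* (+ count d (f c)) ≡ + 0)

Prolongable : ∀ {m} → Morph m → Fin m → Set
Prolongable f a =
  (Σ (Word _) λ u → f a ≡ a ∷ u) ×
  ((N : ℕ) → ∃ λ n0 → (n : ℕ) → n0 ≤ n → N ≤ length (iter f n (a ∷ [])))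

pref : ∀ {m} → ℕ → (ℕ → Fin m) → Word m
pref n x = map x (upTo n)

ConvergesTo : ∀ {m} → (ℕ → Word m) → (ℕ → Fin m) → Set
ConvergesTo w x =
  (L : ℕ) → ∃ λ N → (n : ℕ) → N ≤ n → (L ≤ length (w n)) × (take L (w n) ≡ pref L x)

IsFixedPointLimit : ∀ {m} → Morph m → Fin m → (ℕ → Fin m) → Set
IsFixedPointLimit f a x = ConvergesTo (λ n → iter f n (a ∷ [])) x

eigenvalue : ∀ {m} → Morph m → ℕ
eigenvalue {m} f = sum (map (λ b → count b (f b)) (allFin m))

val : ∀ {k} → List (Fin k) → ℕ
val {k} ds = foldl (λ acc d → acc * k + toℕ d) 0 ds

-- w is the (msd-first) parallel base-k encoding of (n , s): both components
-- have the right values and w has no leading (0,0) symbol, i.e. the canonical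
-- representations with the shorter one padded by leading zeros.
NoLeadingZeroPair : ∀ {k} → List (Fin k × Fin k) → Set
NoLeadingZeroPair [] = ⊤
NoLeadingZeroPair ((d , e) ∷ _) = ¬ (toℕ d ≡ 0 × toℕ e ≡ 0)

Enc : ∀ {k} → ℕ → ℕ → List (Fin k × Fin k) → Set
Enc n s w = (val (map proj₁ w) ≡ n) × (val (map proj₂ w) ≡ s) × NoLeadingZeroPair w

record DFA (k : ℕ) : Set where
  field
    Q      : ℕ
    start  : Fin Q
    δ      : Fin Q → Fin k × Fin k → Fin Q
    final  : Fin Q → Bool

Accepts : ∀ {k} → DFA k → List (Fin k × Fin k) → Set
Accepts M w = DFA.final M (foldl (DFA.δ M) (DFA.start M) w) ≡ true

Synchronized : (k : ℕ) → (ℕ → ℕ) → Set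
Synchronized k s = Σ (DFA k) λ M →
  (w : List (Fin k × Fin k)) →
    (Accepts M w → ∃ λ n → Enc n (s n) w) × ((∃ λ n → Enc n (s n) w) → Accepts M w)

-- Parikh-collinearity gives G Ψ(f c) = wt c Ψ(f a) for every letter c, where G = |f a|_a and
-- wt c = |f c|_a, because the 2×2 minors of collinear vectors vanish. Weighting each letter c by
-- wt c, f multiplies weights by the eigenvalue k, and a word w of weight ℓ w satisfies
-- G |f w| = ℓ w |f a| and G |f w|_b = ℓ w |f a|_b.
--
-- Write n = F p + i with F p = |f (pref p x)| and i < |f (x p)|, and let t be the weight of
-- pref p x. Then G n = |f a| t + G i and G |pref n x|_b = |f a|_b t + G |take i (f (x p))|_b.
-- Since f multiplies weights by k, the letter at a weighted position, and the offset inside it,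
-- can be read off the base-k digits of that position by a finite automaton. A nondeterministic
-- automaton therefore reads n and s in parallel, guesses the digits of t, and checks both linear
-- relations with bounded carries. Determinising it gives the synchronizing DFA.

module Submission where

open import Defs
open import Data.Nat hiding (_≟_)
open import Data.Nat.Properties renaming (_≟_ to _≟ℕ_)
open import Data.Nat.DivMod using (_/_; _%_; m≡m%n+[m/n]*n; m%n<n; m<n*o⇒m/o<n)
open import Data.Nat.ListAction using (sum)
open import Data.Nat.ListAction.Properties using (sum-++)
open import Data.Nat.Tactic.RingSolver using (solve-∀)
open import Data.Integer as ℤ using (ℤ; ∣_∣)
import Data.Integer.Properties as ℤₚ
open import Algebra.Properties.AbelianGroup ℤₚ.+-0-abelianGroup using (inverseˡ-unique)
open import Algebra.Properties.CommutativeSemigroup *-commutativeSemigroup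
  using (x∙yz≈y∙xz; x∙yz≈y∙zx; xy∙z≈xz∙y)
open import Algebra.Properties.Semiring.Sum +-*-semiring
  using (sum-syntax; sum-cong-≗; sum-replicate-zero; ∑-distrib-+; *-distribˡ-sum)
open import Data.Fin using (Fin; toℕ; fromℕ<; funToFin; finToFun) renaming (zero to fzero; suc to fsuc)
open import Data.Fin.Properties using (_≟_; toℕ<n; toℕ-fromℕ<; any?; 2↔Bool; finToFun-funToFin; *↔×)
open import Data.List
  using (List; []; _∷_; _++_; _∷ʳ_; length; filter; map; tabulate; upTo; take; drop; foldl; replicate)
open import Data.List.Properties
  using (length-++; length-map; length-replicate; length-upTo; length-take; length-filter;
         map-++; filter-++; concatMap-++; map-tabulate; upTo-∷ʳ; ++-assoc; ++-identityʳ;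
         ∷-injectiveˡ; ∷ʳ-injectiveʳ; take++drop≡id; foldl-∷ʳ; foldl-++)
open import Data.Product using (Σ; ∃; ∃₂; _×_; _,_; proj₁; proj₂)
open import Data.Product.Properties using (≡-dec)
open import Data.Product.Function.NonDependent.Propositional using (_×-↔_; _×-⇔_)
open import Data.Bool using (Bool; true; false; T)
open import Data.Bool.Properties using (T-≡)
open import Data.Unit using (tt)
open import Function using (_∘_)
open import Function.Bundles using (_⇔_; mk⇔; _↔_; Inverse; Equivalence)
open import Function.Properties.Inverse using (↔-refl; ↔-trans)
open import Function.Properties.Equivalence using () renaming (refl to ⇔-refl; trans to ⇔-trans)
open import Relation.Nullary using (¬_; Dec; does; yes; no; contradiction)
open import Relation.Nullary.Decidable using (isYes; T?; _×-dec_; toWitness; fromWitness)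
open import Relation.Binary using (tri<; tri≈; tri>)
open import Relation.Binary.PropositionalEquality

private
  variable
    m : ℕ

-- Parikh vectors and weights

count-++ : (d : Fin m) (w v : Word m) → count d (w ++ v) ≡ count d w + count d v
count-++ d w v = trans (cong length (filter-++ (_≟ d) w v)) (length-++ (filter (_≟ d) w))

count-suc-[] : (c d : Fin m) → count (fsuc d) (fsuc c ∷ []) ≡ count d (c ∷ [])
count-suc-[] c d with does (c ≟ d)
... | true  = refl
... | false = refl

∑-count-[] : (g : Fin m → ℕ) (c : Fin m) → ∑[ d < m ] (g d * count d (c ∷ [])) ≡ g c
∑-count-[] {suc m} g fzero = begin
  g fzero * 1 + ∑[ d < m ] (g (fsuc d) * 0)   ≡⟨ cong₂ _+_ (*-identityʳ _) (sum-cong-≗ (λ d → *-zeroʳ (g (fsuc d)))) ⟩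
  g fzero + ∑[ d < m ] 0                       ≡⟨ cong (g fzero +_) (sum-replicate-zero m) ⟩
  g fzero + 0                                  ≡⟨ +-identityʳ _ ⟩
  g fzero                                      ∎
  where open ≡-Reasoning
∑-count-[] {suc m} g (fsuc c) = begin
  g fzero * 0 + ∑[ d < m ] (g (fsuc d) * count (fsuc d) (fsuc c ∷ []))
    ≡⟨ cong₂ _+_ (*-zeroʳ (g fzero)) (sum-cong-≗ (λ d → cong (g (fsuc d) *_) (count-suc-[] c d))) ⟩
  ∑[ d < m ] (g (fsuc d) * count d (c ∷ []))
    ≡⟨ ∑-count-[] (λ d → g (fsuc d)) c ⟩
  g (fsuc c) ∎
  where open ≡-Reasoning

weight : (Fin m → ℕ) → Word m → ℕ
weight g w = sum (map g w)

weight-++ : (g : Fin m → ℕ) (w v : Word m) → weight g (w ++ v) ≡ weight g w + weight g v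
weight-++ g w v = trans (cong sum (map-++ g w v)) (sum-++ (map g w) (map g v))

weight-parikh : (g : Fin m → ℕ) (w : Word m) → weight g w ≡ ∑[ d < m ] (g d * count d w)
weight-parikh {m} g [] = sym (trans (sum-cong-≗ (λ d → *-zeroʳ (g d))) (sum-replicate-zero m))
weight-parikh {m} g (c ∷ w) = begin
  g c + weight g w
    ≡⟨ cong₂ _+_ (sym (∑-count-[] g c)) (weight-parikh g w) ⟩
  ∑[ d < m ] (g d * count d (c ∷ [])) + ∑[ d < m ] (g d * count d w)
    ≡⟨ sym (∑-distrib-+ {m} _ _) ⟩
  ∑[ d < m ] (g d * count d (c ∷ []) + g d * count d w)
    ≡⟨ sum-cong-≗ (λ d → trans (sym (*-distribˡ-+ (g d) _ _)) (cong (g d *_) (sym (count-++ d (c ∷ []) w)))) ⟩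
  ∑[ d < m ] (g d * count d (c ∷ w)) ∎
  where open ≡-Reasoning

length≡weight : (w : Word m) → length w ≡ weight (λ _ → 1) w
length≡weight []      = refl
length≡weight (c ∷ w) = cong suc (length≡weight w)

count≡weight : (b : Fin m) (w : Word m) → count b w ≡ weight (λ c → count b (c ∷ [])) w
count≡weight b []      = refl
count≡weight b (c ∷ w) = trans (count-++ b (c ∷ []) w) (cong (count b (c ∷ []) +_) (count≡weight b w))

weight-proportional : {u v : Word m} (G r : ℕ) → (∀ d → G * count d v ≡ r * count d u) →
                      (g : Fin m → ℕ) → G * weight g v ≡ r * weight g u
weight-proportional {m} {u} {v} G r prop g = begin
  G * weight g v                       ≡⟨ cong (G *_) (weight-parikh g v) ⟩
  G * ∑[ d < m ] (g d * count d v)     ≡⟨ *-distribˡ-sum {m} G _ ⟩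
  ∑[ d < m ] (G * (g d * count d v))   ≡⟨ sum-cong-≗ (λ d → x∙yz≈y∙xz G (g d) (count d v)) ⟩
  ∑[ d < m ] (g d * (G * count d v))   ≡⟨ sum-cong-≗ (λ d → cong (g d *_) (prop d)) ⟩
  ∑[ d < m ] (g d * (r * count d u))   ≡⟨ sum-cong-≗ (λ d → x∙yz≈y∙xz (g d) r (count d u)) ⟩
  ∑[ d < m ] (r * (g d * count d u))   ≡⟨ sym (*-distribˡ-sum {m} r _) ⟩
  r * ∑[ d < m ] (g d * count d u)     ≡⟨ cong (r *_) (sym (weight-parikh g u)) ⟩
  r * weight g u                       ∎
  where open ≡-Reasoning

sum-tabulate : (h : Fin m → ℕ) → sum (tabulate h) ≡ ∑[ i < m ] h i
sum-tabulate {zero}  h = refl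
sum-tabulate {suc m} h = cong (h fzero +_) (sum-tabulate (h ∘ fsuc))

eigenvalue≡∑ : (f : Morph m) → eigenvalue f ≡ ∑[ b < m ] count b (f b)
eigenvalue≡∑ {m} f = trans (cong sum (map-tabulate {n = m} (λ i → i) (λ b → count b (f b)))) (sum-tabulate {m} _)

≤-∑ : (h : Fin m → ℕ) (i : Fin m) → h i ≤ ∑[ j < m ] h j
≤-∑ h fzero    = m≤m+n (h fzero) _
≤-∑ h (fsuc i) = ≤-trans (≤-∑ (h ∘ fsuc) i) (m≤n+m _ (h fzero))

count≤length : (b : Fin m) (w : Word m) → count b w ≤ length w
count≤length b = length-filter (_≟ b)

count-head : (c : Fin m) (w : Word m) → count c (c ∷ w) ≡ suc (count c w)
count-head c w with c ≟ c
... | yes _   = refl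
... | no c≢c  = contradiction refl c≢c

apply-++ : (f : Morph m) (w v : Word m) → apply f (w ++ v) ≡ apply f w ++ apply f v
apply-++ f = concatMap-++ f

-- Collinear Parikh vectors

scaled⇒minors : (u v : Fin m → ℕ) (r s : ℕ) .{{_ : NonZero r}} → (∀ d → r * u d ≡ s * v d) →
                ∀ i j → u i * v j ≡ u j * v i
scaled⇒minors u v r s ru≡sv i j = *-cancelˡ-≡ _ _ r (begin
  r * (u i * v j)   ≡⟨ sym (*-assoc r (u i) (v j)) ⟩
  r * u i * v j     ≡⟨ cong (_* v j) (ru≡sv i) ⟩
  s * v i * v j     ≡⟨ xy∙z≈xz∙y s (v i) (v j) ⟩
  s * v j * v i     ≡⟨ cong (_* v i) (sym (ru≡sv j)) ⟩
  r * u j * v i     ≡⟨ *-assoc r (u j) (v i) ⟩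
  r * (u j * v i)   ∎)
  where open ≡-Reasoning

integer-relation⇒scaled : (u v : Fin m → ℕ) (p q : ℤ) →
  (∀ d → p ℤ.* ℤ.+ u d ℤ.+ q ℤ.* ℤ.+ v d ≡ ℤ.+ 0) → ∀ d → ∣ p ∣ * u d ≡ ∣ q ∣ * v d
integer-relation⇒scaled u v p q rel d = begin
  ∣ p ∣ * u d                 ≡⟨ sym (ℤₚ.abs-* p (ℤ.+ u d)) ⟩
  ∣ p ℤ.* ℤ.+ u d ∣           ≡⟨ cong ∣_∣ (inverseˡ-unique (p ℤ.* ℤ.+ u d) (q ℤ.* ℤ.+ v d) (rel d)) ⟩
  ∣ ℤ.- (q ℤ.* ℤ.+ v d) ∣     ≡⟨ ℤₚ.∣-i∣≡∣i∣ (q ℤ.* ℤ.+ v d) ⟩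
  ∣ q ℤ.* ℤ.+ v d ∣           ≡⟨ ℤₚ.abs-* q (ℤ.+ v d) ⟩
  ∣ q ∣ * v d                 ∎
  where open ≡-Reasoning

collinear⇒minors : (u v : Fin m → ℕ) (p q : ℤ) → ¬ (p ≡ ℤ.+ 0 × q ≡ ℤ.+ 0) →
  (∀ d → p ℤ.* ℤ.+ u d ℤ.+ q ℤ.* ℤ.+ v d ≡ ℤ.+ 0) → ∀ i j → u i * v j ≡ u j * v i
collinear⇒minors u v p q nontrivial rel =
  minors ∣ p ∣ ∣ q ∣ (λ (p≡0 , q≡0) → nontrivial (ℤₚ.∣i∣≡0⇒i≡0 p≡0 , ℤₚ.∣i∣≡0⇒i≡0 q≡0))
         (integer-relation⇒scaled u v p q rel)
  where
  minors : ∀ r s → ¬ (r ≡ 0 × s ≡ 0) → (∀ d → r * u d ≡ s * v d) → ∀ i j → u i * v j ≡ u j * v i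
  minors (suc r) s       _  ru≡sv = scaled⇒minors u v (suc r) s ru≡sv
  minors zero    (suc s) _  ru≡sv i j =
    trans (*-comm (u i) (v j)) (trans (scaled⇒minors v u (suc s) 0 (sym ∘ ru≡sv) j i) (*-comm (v i) (u j)))
  minors zero    zero    nz _     = contradiction (refl , refl) nz

-- Measuring the proportionality factor of Ψ(f c) against Ψ(f a) by the number of a's
-- gives G Ψ(f c) = wt c Ψ(f a) with G ≠ 0, since f a begins with a.
module Collinear {m} (f : Morph m) (a : Fin m) (pc : ParikhCollinear f)
                 (fa≡a∷ : Σ (Word m) λ u → f a ≡ a ∷ u) where

  G : ℕ
  G = count a (f a)

  wt : Fin m → ℕ
  wt c = count a (f c)

  ℓ : Word m → ℕ
  ℓ = weight wt

  k : ℕ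
  k = eigenvalue f

  instance
    G≢0 : NonZero G
    G≢0 = subst NonZero (sym (trans (cong (count a) (proj₂ fa≡a∷)) (count-head a (proj₁ fa≡a∷)))) _

    k≢0 : NonZero k
    k≢0 = >-nonZero (≤-trans (>-nonZero⁻¹ G)
                              (subst (G ≤_) (sym (eigenvalue≡∑ f)) (≤-∑ (λ d → count d (f d)) a)))

  proportional : ∀ c d → G * count d (f c) ≡ wt c * count d (f a)
  proportional c d =
    let p , q , nontrivial , rel = pc a c
    in  trans (collinear⇒minors (λ d → count d (f a)) (λ d → count d (f c)) p q nontrivial rel a d)
              (*-comm (count d (f a)) (wt c))

  weight-image : (g : Fin m → ℕ) (c : Fin m) → G * weight g (f c) ≡ wt c * weight g (f a)
  weight-image g c = weight-proportional {u = f a} {v = f c} G (wt c) (proportional c) g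

  weight-apply : (g : Fin m → ℕ) (w : Word m) → G * weight g (apply f w) ≡ ℓ w * weight g (f a)
  weight-apply g []      = *-zeroʳ G
  weight-apply g (c ∷ w) = begin
    G * weight g (f c ++ apply f w)                   ≡⟨ cong (G *_) (weight-++ g (f c) (apply f w)) ⟩
    G * (weight g (f c) + weight g (apply f w))       ≡⟨ *-distribˡ-+ G _ _ ⟩
    G * weight g (f c) + G * weight g (apply f w)     ≡⟨ cong₂ _+_ (weight-image g c) (weight-apply g w) ⟩
    wt c * weight g (f a) + ℓ w * weight g (f a)      ≡⟨ sym (*-distribʳ-+ (weight g (f a)) (wt c) (ℓ w)) ⟩
    (wt c + ℓ w) * weight g (f a)                     ∎
    where open ≡-Reasoning

  count-apply : (b : Fin m) (w : Word m) → G * count b (apply f w) ≡ ℓ w * count b (f a)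
  count-apply b w = subst₂ (λ x y → G * x ≡ ℓ w * y) (sym (count≡weight b (apply f w))) (sym (count≡weight b (f a)))
                           (weight-apply (λ c → count b (c ∷ [])) w)

  length-apply : (w : Word m) → G * length (apply f w) ≡ ℓ w * length (f a)
  length-apply w = subst₂ (λ x y → G * x ≡ ℓ w * y) (sym (length≡weight (apply f w))) (sym (length≡weight (f a)))
                          (weight-apply (λ _ → 1) w)

  ℓ-fa : ℓ (f a) ≡ G * k
  ℓ-fa = begin
    ℓ (f a)                               ≡⟨ weight-parikh wt (f a) ⟩
    ∑[ d < m ] (wt d * count d (f a))     ≡⟨ sum-cong-≗ (λ d → sym (proportional d d)) ⟩
    ∑[ d < m ] (G * count d (f d))        ≡⟨ sym (*-distribˡ-sum {m} G _) ⟩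
    G * ∑[ d < m ] count d (f d)          ≡⟨ cong (G *_) (sym (eigenvalue≡∑ f)) ⟩
    G * k                                 ∎
    where open ≡-Reasoning

  ℓ-image : (c : Fin m) → ℓ (f c) ≡ k * wt c
  ℓ-image c = *-cancelˡ-≡ _ _ G (begin
    G * ℓ (f c)        ≡⟨ weight-image wt c ⟩
    wt c * ℓ (f a)     ≡⟨ cong (wt c *_) ℓ-fa ⟩
    wt c * (G * k)     ≡⟨ x∙yz≈y∙zx (wt c) G k ⟩
    G * (k * wt c)     ∎)
    where open ≡-Reasoning

  ℓ-apply : (w : Word m) → ℓ (apply f w) ≡ k * ℓ w
  ℓ-apply []      = sym (*-zeroʳ k)
  ℓ-apply (c ∷ w) = begin
    ℓ (f c ++ apply f w)          ≡⟨ weight-++ wt (f c) (apply f w) ⟩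
    ℓ (f c) + ℓ (apply f w)       ≡⟨ cong₂ _+_ (ℓ-image c) (ℓ-apply w) ⟩
    k * wt c + k * ℓ w            ≡⟨ sym (*-distribˡ-+ k (wt c) (ℓ w)) ⟩
    k * (wt c + ℓ w)              ∎
    where open ≡-Reasoning

  length-image : (c : Fin m) → G * length (f c) ≡ wt c * length (f a)
  length-image c = subst₂ (λ x y → G * x ≡ wt c * y) (sym (length≡weight (f c))) (sym (length≡weight (f a)))
                          (weight-image (λ _ → 1) c)

  wt-pos : (c : Fin m) → 0 < length (f c) → 0 < wt c
  wt-pos c 0<∣fc∣ = n≢0⇒n>0 λ wt≡0 → >⇒≢ 0<∣fc∣
    (*-cancelˡ-≡ (length (f c)) 0 G (trans (length-image c) (trans (cong (_* length (f a)) wt≡0) (sym (*-zeroʳ G)))))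

-- Prefixes of the fixed point

take-length-++ : {A : Set} (w v : List A) → take (length w) (w ++ v) ≡ w
take-length-++ []      v = refl
take-length-++ (c ∷ w) v = cong (c ∷_) (take-length-++ w v)

++-injectiveˡ : {A : Set} (w w′ : List A) {v v′ : List A} → length w ≡ length w′ → w ++ v ≡ w′ ++ v′ → w ≡ w′
++-injectiveˡ []      []        _  _  = refl
++-injectiveˡ (c ∷ w) (c′ ∷ w′) ∣w∣≡ eq with refl ← ∷-injectiveˡ eq =
  cong (c ∷_) (++-injectiveˡ w w′ (suc-injective ∣w∣≡) (cong (drop 1) eq))

length-pref : (n : ℕ) (x : ℕ → Fin m) → length (pref n x) ≡ n
length-pref n x = trans (length-map x (upTo n)) (length-upTo n)

pref-suc : (n : ℕ) (x : ℕ → Fin m) → pref (suc n) x ≡ pref n x ∷ʳ x n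
pref-suc n x = trans (cong (map x) (sym (upTo-∷ʳ n))) (map-++ x (upTo n) (n ∷ []))

pref-+ : (n j : ℕ) (x : ℕ → Fin m) → pref (n + j) x ≡ pref n x ++ pref j (λ i → x (n + i))
pref-+ n zero    x = trans (cong (λ l → pref l x) (+-identityʳ n)) (sym (++-identityʳ (pref n x)))
pref-+ n (suc j) x = begin
  pref (n + suc j) x                     ≡⟨ cong (λ l → pref l x) (+-suc n j) ⟩
  pref (suc (n + j)) x                   ≡⟨ pref-suc (n + j) x ⟩
  pref (n + j) x ∷ʳ x (n + j)            ≡⟨ cong (_∷ʳ x (n + j)) (pref-+ n j x) ⟩
  (pref n x ++ pref j x′) ∷ʳ x (n + j)   ≡⟨ ++-assoc (pref n x) (pref j x′) (x (n + j) ∷ []) ⟩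
  pref n x ++ (pref j x′ ∷ʳ x′ j)        ≡⟨ cong (pref n x ++_) (sym (pref-suc j x′)) ⟩
  pref n x ++ pref (suc j) x′            ∎
  where
  open ≡-Reasoning
  x′ : ℕ → Fin _
  x′ i = x (n + i)

prefix-of-pref : {x : ℕ → Fin m} {L n : ℕ} (w v : Word m) → w ++ v ≡ pref L x → length w ≡ n → w ≡ pref n x
prefix-of-pref {x = x} {L} {n} w v eq refl = ++-injectiveˡ w (pref n x) (sym (length-pref n x)) (begin
  w ++ v                                   ≡⟨ eq ⟩
  pref L x                                 ≡⟨ cong (λ l → pref l x) L≡ ⟩
  pref (n + length v) x                    ≡⟨ pref-+ n (length v) x ⟩
  pref n x ++ pref (length v) (λ i → x (n + i)) ∎)
  where
  open ≡-Reasoning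
  L≡ : L ≡ length w + length v
  L≡ = trans (sym (length-pref L x)) (trans (cong length (sym eq)) (length-++ w))

crossing-point : (F : ℕ → ℕ) {n : ℕ} (P : ℕ) → F 0 ≤ n → n < F P → ∃ λ p → F p ≤ n × n < F (suc p)
crossing-point F zero    F0≤n n<F0 = contradiction F0≤n (<⇒≱ n<F0)
crossing-point F {n} (suc P) F0≤n n<FP with F P ≤? n
... | yes FP≤n = P , FP≤n , n<FP
... | no  FP≰n = crossing-point F P F0≤n (≰⇒> FP≰n)

module FixedPoint {m} (f : Morph m) (a : Fin m) (x : ℕ → Fin m)
                  (pr : Prolongable f a) (lim : IsFixedPointLimit f a x) where

  I : ℕ → Word m
  I n = iter f n (a ∷ [])

  I-suc-extends : ∀ n → ∃ λ r → I (suc n) ≡ I n ++ r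
  I-suc-extends zero    = proj₁ (proj₁ pr) ++ [] , cong (_++ []) (proj₂ (proj₁ pr))
  I-suc-extends (suc n) with r , eq ← I-suc-extends n = apply f r , trans (cong (apply f) eq) (apply-++ f (I n) r)

  I-extends : ∀ j n → ∃ λ r → I (j + n) ≡ I n ++ r
  I-extends zero    n = [] , sym (++-identityʳ (I n))
  I-extends (suc j) n with r , eq ← I-extends j n | r′ , eq′ ← I-suc-extends (j + n) =
    r ++ r′ , trans eq′ (trans (cong (_++ r′) eq) (++-assoc (I n) r r′))

  I≡pref : ∀ n → I n ≡ pref (length (I n)) x
  I≡pref n with N , conv ← lim (length (I n)) with r , eq ← I-extends N n = begin
    I n                                     ≡⟨ sym (take-length-++ (I n) r) ⟩
    take (length (I n)) (I n ++ r)          ≡⟨ cong (take (length (I n))) (sym eq) ⟩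
    take (length (I n)) (I (N + n))         ≡⟨ proj₂ (conv (N + n) (m≤m+n N n)) ⟩
    pref (length (I n)) x                   ∎
    where open ≡-Reasoning

  x0≡a : x 0 ≡ a
  x0≡a = sym (∷-injectiveˡ (I≡pref 0))

  F : ℕ → ℕ
  F p = length (apply f (pref p x))

  apply-pref : ∀ p → apply f (pref p x) ≡ pref (F p) x
  apply-pref p with n₀ , grows ← proj₂ pr p = prefix-of-pref (apply f (pref p x)) (apply f (pref r x′)) (begin
    apply f (pref p x) ++ apply f (pref r x′)   ≡⟨ sym (apply-++ f (pref p x) (pref r x′)) ⟩
    apply f (pref p x ++ pref r x′)             ≡⟨ cong (apply f) (sym (pref-+ p r x)) ⟩
    apply f (pref (p + r) x)                    ≡⟨ cong (λ l → apply f (pref l x)) (m+[n∸m]≡n (grows n₀ ≤-refl)) ⟩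
    apply f (pref (length (I n₀)) x)            ≡⟨ cong (apply f) (sym (I≡pref n₀)) ⟩
    I (suc n₀)                                  ≡⟨ I≡pref (suc n₀) ⟩
    pref (length (I (suc n₀))) x                ∎) refl
    where
    open ≡-Reasoning
    r = length (I n₀) ∸ p
    x′ : ℕ → Fin m
    x′ i = x (p + i)

  apply-pref-suc : ∀ p → apply f (pref (suc p) x) ≡ apply f (pref p x) ++ f (x p)
  apply-pref-suc p = begin
    apply f (pref (suc p) x)                       ≡⟨ cong (apply f) (pref-suc p x) ⟩
    apply f (pref p x ∷ʳ x p)                      ≡⟨ apply-++ f (pref p x) (x p ∷ []) ⟩
    apply f (pref p x) ++ (f (x p) ++ [])          ≡⟨ cong (apply f (pref p x) ++_) (++-identityʳ (f (x p))) ⟩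
    apply f (pref p x) ++ f (x p)                  ∎
    where open ≡-Reasoning

  F-suc : ∀ p → F (suc p) ≡ F p + length (f (x p))
  F-suc p = trans (cong length (apply-pref-suc p)) (length-++ (apply f (pref p x)))

  pref-F+ : ∀ p (w₁ w₂ : Word m) → f (x p) ≡ w₁ ++ w₂ → pref (F p + length w₁) x ≡ apply f (pref p x) ++ w₁
  pref-F+ p w₁ w₂ split = sym (prefix-of-pref (apply f (pref p x) ++ w₁) w₂ (begin
    (apply f (pref p x) ++ w₁) ++ w₂   ≡⟨ ++-assoc (apply f (pref p x)) w₁ w₂ ⟩
    apply f (pref p x) ++ (w₁ ++ w₂)   ≡⟨ cong (apply f (pref p x) ++_) (sym split) ⟩
    apply f (pref p x) ++ f (x p)      ≡⟨ sym (apply-pref-suc p) ⟩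
    apply f (pref (suc p) x)           ≡⟨ apply-pref (suc p) ⟩
    pref (F (suc p)) x                 ∎) (length-++ (apply f (pref p x))))
    where open ≡-Reasoning

  pref-F+take : ∀ p i → i ≤ length (f (x p)) → pref (F p + i) x ≡ apply f (pref p x) ++ take i (f (x p))
  pref-F+take p i i≤ = subst (λ j → pref (F p + j) x ≡ apply f (pref p x) ++ take i (f (x p)))
    (trans (length-take i (f (x p))) (m≤n⇒m⊓n≡m i≤))
    (pref-F+ p (take i (f (x p))) (drop i (f (x p))) (sym (take++drop≡id i (f (x p)))))

  letter-F+ : ∀ p (w₁ : Word m) c w₂ → f (x p) ≡ w₁ ++ c ∷ w₂ → x (F p + length w₁) ≡ c
  letter-F+ p w₁ c w₂ split = ∷ʳ-injectiveʳ (pref j x) (apply f (pref p x) ++ w₁) (begin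
    pref j x ∷ʳ x j                        ≡⟨ sym (pref-suc j x) ⟩
    pref (suc j) x                         ≡⟨ cong (λ l → pref l x) suc[j]≡ ⟩
    pref (F p + length (w₁ ∷ʳ c)) x        ≡⟨ pref-F+ p (w₁ ∷ʳ c) w₂ (trans split (sym (++-assoc w₁ (c ∷ []) w₂))) ⟩
    apply f (pref p x) ++ (w₁ ∷ʳ c)        ≡⟨ sym (++-assoc (apply f (pref p x)) w₁ (c ∷ [])) ⟩
    (apply f (pref p x) ++ w₁) ∷ʳ c        ∎)
    where
    open ≡-Reasoning
    j = F p + length w₁
    suc[j]≡ : suc j ≡ F p + length (w₁ ∷ʳ c)
    suc[j]≡ = trans (sym (+-suc (F p) (length w₁))) (cong (F p +_) (trans (+-comm 1 (length w₁)) (sym (length-++ w₁))))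

  F-unbounded : ∀ n → ∃ λ P → n < F P
  F-unbounded n with n₀ , grows ← proj₂ pr (suc n) =
    length (I n₀) , subst (n <_) (cong (λ w → length (apply f w)) (I≡pref n₀)) (grows (suc n₀) (n≤1+n n₀))

  decompose : ∀ n → ∃₂ λ p i → i < length (f (x p)) × n ≡ F p + i
  decompose n with P , n<FP ← F-unbounded n with p , Fp≤n , n<F[1+p] ← crossing-point F P z≤n n<FP =
    p , n ∸ F p , +-cancelˡ-< (F p) _ _ (subst₂ _<_ (sym (m+[n∸m]≡n Fp≤n)) (F-suc p) n<F[1+p]) , sym (m+[n∸m]≡n Fp≤n)

-- Weighted positions

-- The default c₀ is a junk value, returned only when t ≥ weight g w.
locate : (g : Fin m → ℕ) → Fin m → Word m → ℕ → Fin m × ℕ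
locate g c₀ []      t = c₀ , 0
locate g c₀ (c ∷ w) t with t <? g c
... | yes _ = c , t
... | no  _ = locate g c₀ w (t ∸ g c)

record Split (g : Fin m → ℕ) (w : Word m) (t : ℕ) (c : Fin m) (o : ℕ) : Set where
  field
    before after : Word m
    split        : w ≡ before ++ c ∷ after
    offset       : weight g before + o ≡ t
    inside       : o < g c

locate-split : (g : Fin m → ℕ) (c₀ : Fin m) (w : Word m) (t : ℕ) → t < weight g w →
               Split g w t (proj₁ (locate g c₀ w t)) (proj₂ (locate g c₀ w t))
locate-split g c₀ (c ∷ w) t t< with t <? g c
... | yes t<gc = record { before = [] ; after = w ; split = refl ; offset = refl ; inside = t<gc }
... | no  t≮gc = record
  { before = c ∷ before ; after = after ; split = cong (c ∷_) split ; inside = inside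
  ; offset = trans (+-assoc (g c) (weight g before) _) (trans (cong (g c +_) offset) (m+[n∸m]≡n gc≤t)) }
  where
  gc≤t = ≮⇒≥ t≮gc
  open Split (locate-split g c₀ w (t ∸ g c) (+-cancelˡ-< (g c) _ _ (subst (_< g c + weight g w) (sym (m+[n∸m]≡n gc≤t)) t<)))

module WeightedPositions {m} (f : Morph m) (a : Fin m) (x : ℕ → Fin m) (pc : ParikhCollinear f)
                         (pr : Prolongable f a) (lim : IsFixedPointLimit f a x) where

  open Collinear f a pc (proj₁ pr) public
  open FixedPoint f a x pr lim public

  W : ℕ → ℕ
  W p = ℓ (pref p x)

  W-suc : ∀ p → W (suc p) ≡ W p + wt (x p)
  W-suc p = trans (cong ℓ (pref-suc p x)) (trans (weight-++ wt (pref p x) (x p ∷ [])) (cong (W p +_) (+-identityʳ (wt (x p)))))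

  W-mono : ∀ {p q} → p ≤ q → W p ≤ W q
  W-mono {p} {q} p≤q = subst (λ r → W p ≤ W r) (m∸n+n≡m p≤q) (W-+ (q ∸ p))
    where
    W-+ : ∀ j → W p ≤ W (j + p)
    W-+ zero    = ≤-refl
    W-+ (suc j) = ≤-trans (W-+ j) (≤-trans (m≤m+n _ _) (≤-reflexive (sym (W-suc (j + p)))))

  W-F+ : ∀ p (w₁ w₂ : Word m) → f (x p) ≡ w₁ ++ w₂ → W (F p + length w₁) ≡ k * W p + ℓ w₁
  W-F+ p w₁ w₂ split = begin
    ℓ (pref (F p + length w₁) x)      ≡⟨ cong ℓ (pref-F+ p w₁ w₂ split) ⟩
    ℓ (apply f (pref p x) ++ w₁)      ≡⟨ weight-++ wt (apply f (pref p x)) w₁ ⟩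
    ℓ (apply f (pref p x)) + ℓ w₁     ≡⟨ cong (_+ ℓ w₁) (ℓ-apply (pref p x)) ⟩
    k * W p + ℓ w₁                    ∎
    where open ≡-Reasoning

  W-earlier : ∀ {p q o o′} → o < wt (x p) → p < q → W p + o < W q + o′
  W-earlier {p} {q} {o} {o′} o< p<q = begin-strict
    W p + o          <⟨ +-monoʳ-< (W p) o< ⟩
    W p + wt (x p)   ≡⟨ sym (W-suc p) ⟩
    W (suc p)        ≤⟨ W-mono p<q ⟩
    W q              ≤⟨ m≤m+n (W q) o′ ⟩
    W q + o′         ∎
    where open ≤-Reasoning

  position-unique : ∀ {p q o o′} → o < wt (x p) → o′ < wt (x q) → W p + o ≡ W q + o′ → p ≡ q
  position-unique {p} {q} o< o′< eq with <-cmp p q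
  ... | tri< p<q _ _ = contradiction eq (<⇒≢ (W-earlier o< p<q))
  ... | tri≈ _ p≡q _ = p≡q
  ... | tri> _ _ q<p = contradiction (sym eq) (<⇒≢ (W-earlier o′< q<p))

  Covers : ℕ → Fin m × ℕ → Set
  Covers t (c , o) = ∃ λ p → x p ≡ c × o < wt c × W p + o ≡ t

  τ : Fin m × ℕ → ℕ → Fin m × ℕ
  τ (c , o) d = locate wt a (f c) (k * o + d)

  covers-start : Covers 0 (a , 0)
  covers-start = 0 , x0≡a , >-nonZero⁻¹ G , refl

  -- Position t k + d falls at offset k o + d inside f (x p), whose weight is k · wt (x p).
  covers-step : ∀ {t c o d} → Covers t (c , o) → d < k → Covers (t * k + d) (τ (c , o) d)
  covers-step {t} {c} {o} {d} (p , refl , o< , Wp+o≡t) d<k =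
    F p + length before , letter-F+ p before _ after split , inside , position
    where
    within : k * o + d < ℓ (f (x p))
    within = begin-strict
      k * o + d       <⟨ +-monoʳ-< (k * o) d<k ⟩
      k * o + k       ≡⟨ trans (+-comm (k * o) k) (sym (*-suc k o)) ⟩
      k * suc o       ≤⟨ *-monoʳ-≤ k o< ⟩
      k * wt (x p)    ≡⟨ sym (ℓ-image (x p)) ⟩
      ℓ (f (x p))     ∎
      where open ≤-Reasoning
    open Split (locate-split wt a (f (x p)) (k * o + d) within)
    position : W (F p + length before) + proj₂ (τ (x p , o) d) ≡ t * k + d
    position = begin
      W (F p + length before) + _              ≡⟨ cong (_+ _) (W-F+ p before _ split) ⟩
      k * W p + ℓ before + _                   ≡⟨ +-assoc (k * W p) (ℓ before) _ ⟩
      k * W p + (ℓ before + _)                 ≡⟨ cong (k * W p +_) offset ⟩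
      k * W p + (k * o + d)                    ≡⟨ sym (+-assoc (k * W p) (k * o) d) ⟩
      k * W p + k * o + d                      ≡⟨ cong (_+ d) (sym (*-distribˡ-+ k (W p) o)) ⟩
      k * (W p + o) + d                        ≡⟨ cong (λ t → k * t + d) Wp+o≡t ⟩
      k * t + d                                ≡⟨ cong (_+ d) (*-comm k t) ⟩
      t * k + d                                ∎
      where open ≡-Reasoning

  covers-unique : ∀ {t c o c′ o′} → Covers t (c , o) → Covers t (c′ , o′) → c ≡ c′ × o ≡ o′
  covers-unique (p , refl , o< , eq) (q , refl , o′< , eq′) with refl ← position-unique o< o′< (trans eq (sym eq′)) =
    refl , +-cancelˡ-≡ (W p) _ _ (trans eq (sym eq′))

-- Base-k numerals and carries

valFrom : {k : ℕ} → ℕ → List (Fin k) → ℕ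
valFrom {k} = foldl (λ acc d → acc * k + toℕ d)

module _ {k : ℕ} where

  valFrom-split : (n : ℕ) (ds : List (Fin k)) → valFrom n ds ≡ n * k ^ length ds + val ds
  valFrom-split n []       = sym (trans (+-identityʳ (n * 1)) (*-identityʳ n))
  valFrom-split n (d ∷ ds) = begin
    valFrom (n * k + toℕ d) ds                                   ≡⟨ valFrom-split (n * k + toℕ d) ds ⟩
    (n * k + toℕ d) * q + val ds                                 ≡⟨ regroup n k (toℕ d) q (val ds) ⟩
    n * (k * q) + (toℕ d * q + val ds)                           ≡⟨ cong (n * (k * q) +_) (sym (valFrom-split (toℕ d) ds)) ⟩
    n * (k * q) + valFrom (toℕ d) ds                             ∎
    where
    open ≡-Reasoning
    q = k ^ length ds
    regroup : ∀ n k d q v → (n * k + d) * q + v ≡ n * (k * q) + (d * q + v)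
    regroup = solve-∀

  valFrom< : (n : ℕ) (ds : List (Fin k)) → valFrom n ds < suc n * k ^ length ds
  valFrom< n []       = subst (n <_) (sym (*-identityʳ (suc n))) ≤-refl
  valFrom< n (d ∷ ds) = <-≤-trans (valFrom< (n * k + toℕ d) ds)
    (≤-trans (*-monoˡ-≤ (k ^ length ds) next-digit) (≤-reflexive (*-assoc (suc n) k (k ^ length ds))))
    where
    next-digit : suc (n * k + toℕ d) ≤ suc n * k
    next-digit = subst (suc (n * k + toℕ d) ≤_) (+-comm (n * k) k)
                   (subst (_≤ n * k + k) (+-suc (n * k) (toℕ d)) (+-monoʳ-≤ (n * k) (toℕ<n d)))

  val< : (ds : List (Fin k)) → val ds < k ^ length ds
  val< ds = subst (val ds <_) (+-identityʳ (k ^ length ds)) (valFrom< 0 ds)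

  digits : .{{_ : NonZero k}} (L t : ℕ) → t < k ^ L → ∃ λ (ds : List (Fin k)) → length ds ≡ L × val ds ≡ t
  digits zero    t t<1 = [] , refl , sym (n<1⇒n≡0 t<1)
  digits (suc L) t t<  with ds , ∣ds∣≡L , val≡ ← digits L (t / k) (m<n*o⇒m/o<n (subst (t <_) (*-comm k (k ^ L)) t<)) =
    ds ∷ʳ fromℕ< (m%n<n t k) ,
    trans (length-++ ds) (trans (+-comm (length ds) 1) (cong suc ∣ds∣≡L)) ,
    (begin
      val (ds ∷ʳ fromℕ< (m%n<n t k))            ≡⟨ foldl-∷ʳ (λ acc d → acc * k + toℕ d) 0 (fromℕ< (m%n<n t k)) ds ⟩
      val ds * k + toℕ (fromℕ< (m%n<n t k))     ≡⟨ cong₂ (λ q r → q * k + r) val≡ (toℕ-fromℕ< (m%n<n t k)) ⟩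
      t / k * k + t % k                        ≡⟨ +-comm (t / k * k) (t % k) ⟩
      t % k + t / k * k                        ≡⟨ sym (m≡m%n+[m/n]*n t k) ⟩
      t                                        ∎)
    where open ≡-Reasoning

  val-padded : {A : Set} (π : A → Fin k) {z : A} → toℕ (π z) ≡ 0 → (r : ℕ) (w : List A) →
               val (map π (replicate r z ++ w)) ≡ val (map π w)
  val-padded π {z} π[z]≡0 zero    w = refl
  val-padded π {z} π[z]≡0 (suc r) w = trans (cong (λ acc → valFrom acc (map π (replicate r z ++ w))) π[z]≡0)
                                        (val-padded π π[z]≡0 r w)

1+n≤k^n : {k : ℕ} → 2 ≤ k → (n : ℕ) → suc n ≤ k ^ n
1+n≤k^n 2≤k zero    = ≤-refl
1+n≤k^n {k} 2≤k (suc n) = begin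
  1 + suc n       ≤⟨ +-monoˡ-≤ (suc n) (s≤s z≤n) ⟩
  suc n + suc n   ≡⟨ cong (suc n +_) (sym (+-identityʳ (suc n))) ⟩
  2 * suc n       ≤⟨ *-mono-≤ 2≤k (1+n≤k^n 2≤k n) ⟩
  k * k ^ n       ∎
  where open ≤-Reasoning

*-<-^ : {k : ℕ} .{{_ : NonZero k}} (G : ℕ) {n r : ℕ} → n < k ^ r → G * n < k ^ (G + r)
*-<-^ {suc zero}    G {n} {r} n<1 rewrite ^-zeroˡ r | n<1⇒n≡0 n<1 | *-zeroʳ G = subst (0 <_) (sym (^-zeroˡ (G + r))) z<s
*-<-^ {k@(suc (suc _))} G {n} {r} n<k^r = begin-strict
  G * n             ≤⟨ *-monoʳ-≤ G (<⇒≤ n<k^r) ⟩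
  G * k ^ r         <⟨ m<n+m (G * k ^ r) (m^n>0 k r) ⟩
  suc G * k ^ r     ≤⟨ *-monoˡ-≤ (k ^ r) (1+n≤k^n (s≤s (s≤s z≤n)) G) ⟩
  k ^ G * k ^ r     ≡⟨ sym (^-distribˡ-+-* k G r) ⟩
  k ^ (G + r)       ∎
  where open ≤-Reasoning

-- The carry α = G n + M − C t of (n , t) determines the carry of (n K + e , t K + d),
-- namely K α + G e − C d + M − K M.
carry-step : {K G M C α α′ t n e d : ℕ} → α + C * t ≡ G * n + M →
  (α′ + (K * M + C * d) ≡ K * α + G * e + M) ⇔ (α′ + C * (t * K + d) ≡ G * (n * K + e) + M)
carry-step {K} {G} {M} {C} {α} {α′} {t} {n} {e} {d} carry = mk⇔
  (λ eq → +-cancelʳ-≡ (K * M) _ _ (trans (sym shift-left) (trans (cong (_+ K * (C * t)) eq) shift-right)))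
  (λ eq → +-cancelʳ-≡ (K * (C * t)) _ _ (trans shift-left (trans (cong (_+ K * M) eq) (sym shift-right))))
  where
  open ≡-Reasoning
  shift-left : α′ + (K * M + C * d) + K * (C * t) ≡ α′ + C * (t * K + d) + K * M
  shift-left = lemma α′ K M C d t
    where
    lemma : ∀ α′ K M C d t → α′ + (K * M + C * d) + K * (C * t) ≡ α′ + C * (t * K + d) + K * M
    lemma = solve-∀
  shift-right : K * α + G * e + M + K * (C * t) ≡ G * (n * K + e) + M + K * M
  shift-right = begin
    K * α + G * e + M + K * (C * t)   ≡⟨ lemma₁ K α G e M C t ⟩
    K * (α + C * t) + G * e + M       ≡⟨ cong (λ β → K * β + G * e + M) carry ⟩
    K * (G * n + M) + G * e + M       ≡⟨ lemma₂ K G n M e ⟩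
    G * (n * K + e) + M + K * M       ∎
    where
    lemma₁ : ∀ K α G e M C t → K * α + G * e + M + K * (C * t) ≡ K * (α + C * t) + G * e + M
    lemma₁ = solve-∀
    lemma₂ : ∀ K G n M e → K * (G * n + M) + G * e + M ≡ G * (n * K + e) + M + K * M
    lemma₂ = solve-∀

module _ {G C Q n₁ n₂ t₁ t₂ i : ℕ} (scaled : G * (n₁ * Q + n₂) ≡ C * (t₁ * Q + t₂) + G * i) where

  truncated-lower : .{{_ : NonZero G}} → n₂ < Q → C * t₁ < G * n₁ + G
  truncated-lower n₂<Q = *-cancelʳ-< Q (C * t₁) (G * n₁ + G) (begin-strict
    C * t₁ * Q                       ≤⟨ m≤m+n (C * t₁ * Q) (C * t₂) ⟩
    C * t₁ * Q + C * t₂              ≡⟨ sym (distrib C t₁ Q t₂) ⟩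
    C * (t₁ * Q + t₂)                ≤⟨ m≤m+n _ (G * i) ⟩
    C * (t₁ * Q + t₂) + G * i        ≡⟨ sym scaled ⟩
    G * (n₁ * Q + n₂)                ≡⟨ distrib G n₁ Q n₂ ⟩
    G * n₁ * Q + G * n₂              <⟨ +-monoʳ-< (G * n₁ * Q) (*-monoʳ-< G n₂<Q) ⟩
    G * n₁ * Q + G * Q               ≡⟨ sym (*-distribʳ-+ Q (G * n₁) G) ⟩
    (G * n₁ + G) * Q                 ∎)
    where
    open ≤-Reasoning
    distrib : ∀ a b q c → a * (b * q + c) ≡ a * b * q + a * c
    distrib = solve-∀

  truncated-upper : {L : ℕ} .{{_ : NonZero Q}} → t₂ ≤ Q → i ≤ L → G * n₁ ≤ C * t₁ + C + G * L
  truncated-upper {L} t₂≤Q i≤L = *-cancelʳ-≤ (G * n₁) (C * t₁ + C + G * L) Q (begin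
    G * n₁ * Q                         ≤⟨ m≤m+n (G * n₁ * Q) (G * n₂) ⟩
    G * n₁ * Q + G * n₂                ≡⟨ sym (distrib G n₁ Q n₂) ⟩
    G * (n₁ * Q + n₂)                  ≡⟨ scaled ⟩
    C * (t₁ * Q + t₂) + G * i          ≡⟨ cong (_+ G * i) (distrib C t₁ Q t₂) ⟩
    C * t₁ * Q + C * t₂ + G * i        ≤⟨ +-mono-≤ (+-monoʳ-≤ (C * t₁ * Q) (*-monoʳ-≤ C t₂≤Q))
                                                    (≤-trans (*-monoʳ-≤ G i≤L) (m≤m*n (G * L) Q)) ⟩
    C * t₁ * Q + C * Q + G * L * Q     ≡⟨ collect C t₁ Q G L ⟩
    (C * t₁ + C + G * L) * Q           ∎)
    where
    open ≤-Reasoning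
    distrib : ∀ a b q c → a * (b * q + c) ≡ a * b * q + a * c
    distrib = solve-∀
    collect : ∀ C t Q G L → C * t * Q + C * Q + G * L * Q ≡ (C * t + C + G * L) * Q
    collect = solve-∀

offset-cancel : {α X Y v M : ℕ} → α + X ≡ Y + M → α ≡ v + M → Y ≡ X + v
offset-cancel {α} {X} {Y} {v} {M} eq α≡ = +-cancelʳ-≡ M Y (X + v) (begin
  Y + M          ≡⟨ sym eq ⟩
  α + X          ≡⟨ cong (_+ X) α≡ ⟩
  v + M + X      ≡⟨ rearrange v M X ⟩
  X + v + M      ∎)
  where
  open ≡-Reasoning
  rearrange : ∀ v M X → v + M + X ≡ X + v + M
  rearrange = solve-∀

offset-intro : {α X Y v M : ℕ} → α + X ≡ Y + M → Y ≡ X + v → α ≡ v + M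
offset-intro {α} {X} {Y} {v} {M} eq Y≡ = +-cancelʳ-≡ X α (v + M) (begin
  α + X          ≡⟨ eq ⟩
  Y + M          ≡⟨ cong (_+ M) Y≡ ⟩
  X + v + M      ≡⟨ rearrange X v M ⟩
  v + M + X      ∎)
  where
  open ≡-Reasoning
  rearrange : ∀ X v M → X + v + M ≡ v + M + X
  rearrange = solve-∀

-- Automata

record NFA (A : Set) : Set₁ where
  field
    State  : Set
    size   : ℕ
    states : Fin size ↔ State
    start  : State
    Step   : State → A → State → Set
    step?  : ∀ q z q′ → Dec (Step q z q′)
    Final  : State → Set
    final? : ∀ q → Dec (Final q)

module _ {A : Set} (N : NFA A) where
  open NFA N

  data Run : State → List A → State → Set where
    []  : ∀ {q} → Run q [] q
    _∷_ : ∀ {q q₁ q₂ z zs} → Step q z q₁ → Run q₁ zs q₂ → Run q (z ∷ zs) q₂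

  NAccepts : List A → Set
  NAccepts w = ∃ λ q → Run start w q × Final q

module SubsetConstruction {k : ℕ} (N : NFA (Fin k × Fin k)) where
  open NFA N

  state : Fin size → State
  state = Inverse.to states

  index : State → Fin size
  index = Inverse.from states

  state-index : ∀ q → state (index q) ≡ q
  state-index = Inverse.strictlyInverseˡ states

  index-state : ∀ j → index (state j) ≡ j
  index-state = Inverse.strictlyInverseʳ states

  Subset : Set
  Subset = Fin size → Bool

  encode : Subset → Fin (2 ^ size)
  encode S = funToFin (Inverse.from 2↔Bool ∘ S)

  decode : Fin (2 ^ size) → Subset
  decode i = Inverse.to 2↔Bool ∘ finToFun i

  decode-encode : ∀ S j → decode (encode S) j ≡ S j
  decode-encode S j = trans (cong (Inverse.to 2↔Bool) (finToFun-funToFin _ j)) (Inverse.strictlyInverseˡ 2↔Bool (S j))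

  successors : Subset → Fin k × Fin k → Subset
  successors S z j′ = isYes (any? λ j → T? (S j) ×-dec step? (state j) z (state j′))

  accepting : Subset → Bool
  accepting S = isYes (any? λ j → T? (S j) ×-dec final? (state j))

  dfa : DFA k
  dfa = record
    { Q     = 2 ^ size
    ; start = encode (λ j → isYes (j ≟ index start))
    ; δ     = λ i z → encode (successors (decode i) z)
    ; final = accepting ∘ decode
    }

  open DFA dfa using (δ)

  reached-sound : ∀ i w j → T (decode (foldl δ i w) j) → ∃ λ j₀ → T (decode i j₀) × Run N (state j₀) w (state j)
  reached-sound i []      j j∈ = j , j∈ , []
  reached-sound i (z ∷ w) j j∈
    with j₁ , j₁∈ , run ← reached-sound (δ i z) w j j∈
    with j₀ , j₀∈ , step ← toWitness (subst T (decode-encode _ j₁) j₁∈)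
    = j₀ , j₀∈ , step ∷ run

  reached-complete : ∀ i w j₀ {q} → T (decode i j₀) → Run N (state j₀) w q → T (decode (foldl δ i w) (index q))
  reached-complete i [] j₀ j₀∈ [] = subst (λ j → T (decode i j)) (sym (index-state j₀)) j₀∈
  reached-complete i (z ∷ w) j₀ {q} j₀∈ (_∷_ {q₁ = q₁} step run) =
    reached-complete (δ i z) w (index q₁)
      (subst T (sym (decode-encode _ (index q₁)))
        (fromWitness (j₀ , j₀∈ , subst (Step (state j₀) z) (sym (state-index q₁)) step)))
      (subst (λ q′ → Run N q′ w q) (sym (state-index q₁)) run)

  dfa-accepts : ∀ w → Accepts dfa w ⇔ NAccepts N w
  dfa-accepts w = mk⇔ sound complete
    where
    sound : Accepts dfa w → NAccepts N w
    sound acc with j , j∈ , fin ← toWitness (Equivalence.from T-≡ acc)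
              with j₀ , j₀∈ , run ← reached-sound (DFA.start dfa) w j j∈
              with refl ← toWitness (subst T (decode-encode _ j₀) j₀∈) =
      state j , subst (λ q → Run N q w (state j)) (state-index start) run , fin
    complete : NAccepts N w → Accepts dfa w
    complete (q , run , fin) = Equivalence.to T-≡ (fromWitness (index q , j∈ , subst Final (sym (state-index q)) fin))
      where
      j∈ : T (decode (foldl δ (DFA.start dfa) w) (index q))
      j∈ = reached-complete (DFA.start dfa) w (index start) (subst T (sym (decode-encode _ (index start))) (fromWitness refl))
             (subst (λ q′ → Run N q′ w q) (sym (state-index start)) run)

module _ {k : ℕ} where

  restart : DFA k → List (Fin k × Fin k) → DFA k
  restart M z = record M { start = foldl (DFA.δ M) (DFA.start M) z }

  accepts-restart : (M : DFA k) (z w : List (Fin k × Fin k)) → Accepts (restart M z) w ⇔ Accepts M (z ++ w)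
  accepts-restart M z w = mk⇔ (subst accepting (sym run)) (subst accepting run)
    where
    accepting : Fin (DFA.Q M) → Set
    accepting q = DFA.final M q ≡ true
    run : foldl (DFA.δ M) (DFA.start M) (z ++ w) ≡ foldl (DFA.δ M) (DFA.start (restart M z)) w
    run = foldl-++ (DFA.δ M) (DFA.start M) z w

  ZeroPair : Fin k × Fin k → Set
  ZeroPair (d , e) = toℕ d ≡ 0 × toℕ e ≡ 0

  zero-pair? : ∀ z → Dec (ZeroPair z)
  zero-pair? (d , e) = (toℕ d ≟ℕ 0) ×-dec (toℕ e ≟ℕ 0)

  -- A fresh start state rejects a leading (0,0); the second new state is a sink.
  guard : DFA k → DFA k
  guard M = record { Q = suc (suc Q) ; start = fzero ; δ = δ′ ; final = final′ }
    where
    open DFA M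
    δ′ : Fin (suc (suc Q)) → Fin k × Fin k → Fin (suc (suc Q))
    δ′ fzero            z with zero-pair? z
    ... | yes _ = fsuc fzero
    ... | no  _ = fsuc (fsuc (δ start z))
    δ′ (fsuc fzero)     z = fsuc fzero
    δ′ (fsuc (fsuc q))  z = fsuc (fsuc (δ q z))
    final′ : Fin (suc (suc Q)) → Bool
    final′ fzero           = final start
    final′ (fsuc fzero)    = false
    final′ (fsuc (fsuc q)) = final q

  accepts-guard : (M : DFA k) (w : List (Fin k × Fin k)) → Accepts (guard M) w ⇔ (NoLeadingZeroPair w × Accepts M w)
  accepts-guard M []      = mk⇔ (tt ,_) proj₂
  accepts-guard M (z ∷ w) with zero-pair? z
  ... | yes zp = mk⇔ (λ acc → contradiction (trans (cong (DFA.final (guard M)) (sym (sink w))) acc) λ ())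
                     (λ (nlz , _) → contradiction zp nlz)
    where
    sink : ∀ w → foldl (DFA.δ (guard M)) (fsuc fzero) w ≡ fsuc fzero
    sink []      = refl
    sink (_ ∷ w) = sink w
  ... | no ¬zp = mk⇔ (λ acc → ¬zp , subst (λ q → DFA.final (guard M) q ≡ true) (lift w (DFA.δ M (DFA.start M) z)) acc)
                     (λ (_ , acc) → subst (λ q → DFA.final (guard M) q ≡ true) (sym (lift w (DFA.δ M (DFA.start M) z))) acc)
    where
    lift : ∀ w q → foldl (DFA.δ (guard M)) (fsuc (fsuc q)) w ≡ fsuc (fsuc (foldl (DFA.δ M) q w))
    lift []      q = refl
    lift (z ∷ w) q = lift w (DFA.δ M q z)

synchronized-by : {k : ℕ} {s : ℕ → ℕ} (M : DFA k) →
  (∀ w → Accepts M w ⇔ (NoLeadingZeroPair w × val (map proj₂ w) ≡ s (val (map proj₁ w)))) → Synchronized k s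
synchronized-by {s = s} M accepts = M , λ w →
  (λ acc → let nlz , graph = Equivalence.to (accepts w) acc in val (map proj₁ w) , refl , graph , nlz) ,
  (λ (n , val₁≡n , val₂≡s , nlz) → Equivalence.from (accepts w) (nlz , trans val₂≡s (cong s (sym val₁≡n))))

-- The synchronizing automaton

module Synchronizing {m} (f : Morph m) (a : Fin m) (x : ℕ → Fin m) (pc : ParikhCollinear f)
                     (pr : Prolongable f a) (lim : IsFixedPointLimit f a x) (b : Fin m) where

  open WeightedPositions f a x pc pr lim

  U : ℕ
  U = length (f a)

  Ub : ℕ
  Ub = count b (f a)

  L : ℕ
  L = ∑[ c < m ] length (f c)

  -- Slack keeping every carry G n + M − C t of a prefix non-negative and below 2M.
  M : ℕ
  M = G * L + U + G

  R : ℕ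
  R = suc (M + M)

  State : Set
  State = Fin m × Fin (suc L) × Fin R × Fin R

  Carry : ℕ → Fin R → Fin R → Fin k → Fin k → Set
  Carry C α α′ e d = toℕ α′ + (k * M + C * toℕ d) ≡ k * toℕ α + G * toℕ e + M

  -- The automaton guesses the digit d of t and tracks t's letter and offset together with the
  -- carries of n against t (for lengths) and of s against t (for b's).
  Step : State → Fin k × Fin k → State → Set
  Step (c , o , α , β) (e , e′) (c′ , o′ , α′ , β′) =
    ∃ λ (d : Fin k) → τ (c , toℕ o) (toℕ d) ≡ (c′ , toℕ o′) × Carry U α α′ e d × Carry Ub β β′ e′ d

  Final : State → Set
  Final (c , o , α , β) =
    toℕ o ≡ 0 × ∃ λ i → i < length (f c) × (toℕ α ≡ G * i + M × toℕ β ≡ G * count b (take i (f c)) + M)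

  M<R : M < R
  M<R = s≤s (m≤m+n M M)

  enumeration : Fin (m * (suc L * (R * R))) ↔ State
  enumeration = ↔-trans *↔× (↔-refl ×-↔ ↔-trans *↔× (↔-refl ×-↔ *↔×))

  step? : ∀ q z q′ → Dec (Step q z q′)
  step? (c , o , α , β) (e , e′) (c′ , o′ , α′ , β′) = any? λ d →
    ≡-dec _≟_ _≟ℕ_ (τ (c , toℕ o) (toℕ d)) (c′ , toℕ o′) ×-dec (_ ≟ℕ _) ×-dec (_ ≟ℕ _)

  final? : ∀ q → Dec (Final q)
  final? (c , o , α , β) = (toℕ o ≟ℕ 0) ×-dec
    anyUpTo? (λ i → (toℕ α ≟ℕ G * i + M) ×-dec (toℕ β ≟ℕ G * count b (take i (f c)) + M)) (length (f c))

  automaton : NFA (Fin k × Fin k)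
  automaton = record
    { State  = State
    ; size   = m * (suc L * (R * R))
    ; states = enumeration
    ; start  = a , fzero , fromℕ< M<R , fromℕ< M<R
    ; Step   = Step
    ; step?  = step?
    ; Final  = Final
    ; final? = final?
    }

  -- n and s are the numbers read so far and t the number guessed so far.
  Invariant : ℕ → ℕ → ℕ → State → Set
  Invariant n s t (c , o , α , β) =
    Covers t (c , toℕ o) × toℕ α + U * t ≡ G * n + M × toℕ β + Ub * t ≡ G * s + M

  invariant-start : Invariant 0 0 0 (NFA.start automaton)
  invariant-start = covers-start , start-carry U , start-carry Ub
    where
    start-carry : ∀ C → toℕ (fromℕ< M<R) + C * 0 ≡ G * 0 + M
    start-carry C = trans (cong₂ _+_ (toℕ-fromℕ< M<R) (*-zeroʳ C)) (trans (+-identityʳ M) (cong (_+ M) (sym (*-zeroʳ G))))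

  step-sound : ∀ {n s t q e e′ q′} → Invariant n s t q → Step q (e , e′) q′ →
               ∃ λ t′ → Invariant (n * k + toℕ e) (s * k + toℕ e′) t′ q′
  step-sound {t = t} (covers , α-inv , β-inv) (d , τ≡ , α-carry , β-carry) =
    t * k + toℕ d ,
    subst (Covers _) τ≡ (covers-step covers (toℕ<n d)) ,
    Equivalence.to (carry-step {k} {G} {M} {U} α-inv) α-carry ,
    Equivalence.to (carry-step {k} {G} {M} {Ub} β-inv) β-carry

  run-sound : ∀ {q zs q′} → Run automaton q zs q′ → ∀ {n s t} → Invariant n s t q →
              ∃ λ t′ → Invariant (valFrom n (map proj₁ zs)) (valFrom s (map proj₂ zs)) t′ q′
  run-sound []           inv = _ , inv
  run-sound (step ∷ run) inv = run-sound run (proj₂ (step-sound inv step))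

  scaled-length : ∀ p i → G * (F p + i) ≡ U * W p + G * i
  scaled-length p i = begin
    G * (F p + i)                        ≡⟨ *-distribˡ-+ G (F p) i ⟩
    G * F p + G * i                      ≡⟨ cong (_+ G * i) (trans (length-apply (pref p x)) (*-comm (W p) U)) ⟩
    U * W p + G * i                      ∎
    where open ≡-Reasoning

  scaled-count : ∀ p i → i ≤ length (f (x p)) →
                 G * count b (pref (F p + i) x) ≡ Ub * W p + G * count b (take i (f (x p)))
  scaled-count p i i≤ = begin
    G * count b (pref (F p + i) x)                                  ≡⟨ cong (λ w → G * count b w) (pref-F+take p i i≤) ⟩
    G * count b (apply f (pref p x) ++ take i (f (x p)))            ≡⟨ cong (G *_) (count-++ b (apply f (pref p x)) _) ⟩
    G * (count b (apply f (pref p x)) + count b (take i (f (x p)))) ≡⟨ *-distribˡ-+ G _ _ ⟩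
    G * count b (apply f (pref p x)) + G * count b (take i (f (x p)))
      ≡⟨ cong (_+ G * count b (take i (f (x p)))) (trans (count-apply b (pref p x)) (*-comm (W p) Ub)) ⟩
    Ub * W p + G * count b (take i (f (x p)))                       ∎
    where open ≡-Reasoning

  final-sound : ∀ {n s t q} → Invariant n s t q → Final q → s ≡ count b (pref n x)
  final-sound {n} {s} {t} {c , o , α , β} ((p , refl , _ , Wp+o≡t) , α-inv , β-inv) (o≡0 , i , i< , α≡ , β≡) =
    *-cancelˡ-≡ s (count b (pref n x)) G (begin
      G * s                                            ≡⟨ offset-cancel β-inv β≡ ⟩
      Ub * t + G * count b (take i (f (x p)))          ≡⟨ cong (λ t → Ub * t + _) t≡Wp ⟩
      Ub * W p + G * count b (take i (f (x p)))        ≡⟨ sym (scaled-count p i (<⇒≤ i<)) ⟩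
      G * count b (pref (F p + i) x)                   ≡⟨ cong (λ n → G * count b (pref n x)) (sym n≡) ⟩
      G * count b (pref n x)                           ∎)
    where
    open ≡-Reasoning
    t≡Wp : t ≡ W p
    t≡Wp = trans (sym Wp+o≡t) (trans (cong (W p +_) o≡0) (+-identityʳ (W p)))
    n≡ : n ≡ F p + i
    n≡ = *-cancelˡ-≡ n (F p + i) G (begin
      G * n              ≡⟨ offset-cancel α-inv α≡ ⟩
      U * t + G * i      ≡⟨ cong (λ t → U * t + G * i) t≡Wp ⟩
      U * W p + G * i    ≡⟨ sym (scaled-length p i) ⟩
      G * (F p + i)      ∎)

  final-complete : ∀ {n s t q} p i → Invariant n s t q → i < length (f (x p)) →
                   n ≡ F p + i → t ≡ W p → s ≡ count b (pref n x) → Final q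
  final-complete {q = c , o , α , β} p i (covers , α-inv , β-inv) i< refl refl refl =
    o≡0 , i , subst (λ c → i < length (f c)) x[p]≡c i< ,
    offset-intro α-inv (scaled-length p i) ,
    subst (λ c → toℕ β ≡ G * count b (take i (f c)) + M) x[p]≡c (offset-intro β-inv (scaled-count p i (<⇒≤ i<)))
    where
    unique = covers-unique (p , refl , wt-pos (x p) (≤-<-trans z≤n i<) , +-identityʳ (W p)) covers
    x[p]≡c = proj₁ unique
    o≡0 = sym (proj₂ unique)

  Window : ℕ → ℕ → ℕ → Set
  Window C t n = ∃ λ v → v < R × v + C * t ≡ G * n + M

  window : ∀ {C j n₁ n₂ t₁ t₂ r} → C ≤ U → j ≤ L → n₂ < k ^ r → t₂ ≤ k ^ r →
           G * (n₁ * k ^ r + n₂) ≡ C * (t₁ * k ^ r + t₂) + G * j → Window C t₁ n₁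
  window {C} {j} {n₁} {n₂} {t₁} {t₂} {r} C≤U j≤L n₂< t₂≤ scaled =
    G * n₁ + M ∸ C * t₁ , s≤s (+-cancelʳ-≤ (C * t₁) _ (M + M) upper) , m∸n+n≡m Ct₁≤
    where
    instance _ = m^n≢0 k r
    Ct₁≤ : C * t₁ ≤ G * n₁ + M
    Ct₁≤ = ≤-trans (<⇒≤ (truncated-lower {G = G} {C = C} scaled n₂<)) (+-monoʳ-≤ (G * n₁) (m≤n+m G (G * L + U)))
    upper : G * n₁ + M ∸ C * t₁ + C * t₁ ≤ M + M + C * t₁
    upper = begin
      G * n₁ + M ∸ C * t₁ + C * t₁     ≡⟨ m∸n+n≡m Ct₁≤ ⟩
      G * n₁ + M                       ≤⟨ +-monoˡ-≤ M (truncated-upper {G = G} {C = C} scaled t₂≤ j≤L) ⟩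
      C * t₁ + C + G * L + M           ≡⟨ cong (_+ M) (+-assoc (C * t₁) C (G * L)) ⟩
      C * t₁ + (C + G * L) + M         ≤⟨ +-monoˡ-≤ M (+-monoʳ-≤ (C * t₁) C+GL≤M) ⟩
      C * t₁ + M + M                   ≡⟨ trans (+-assoc (C * t₁) M M) (+-comm (C * t₁) (M + M)) ⟩
      M + M + C * t₁                   ∎
      where
      open ≤-Reasoning
      C+GL≤M : C + G * L ≤ M
      C+GL≤M = ≤-trans (≤-reflexive (+-comm C (G * L))) (≤-trans (+-monoʳ-≤ (G * L) C≤U) (m≤m+n (G * L + U) G))

  step-complete : ∀ {n s t q} e e′ d → Invariant n s t q →
                  Window U (t * k + toℕ d) (n * k + toℕ e) → Window Ub (t * k + toℕ d) (s * k + toℕ e′) →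
                  ∃ λ q′ → Step q (e , e′) q′ × Invariant (n * k + toℕ e) (s * k + toℕ e′) (t * k + toℕ d) q′
  step-complete {q = c , o , α , β} e e′ d (covers , α-inv , β-inv) (v , v<R , α-inv′) (w , w<R , β-inv′) =
    (c′ , fromℕ< o′<1+L , fromℕ< v<R , fromℕ< w<R) ,
    (d , cong (c′ ,_) (sym (toℕ-fromℕ< o′<1+L)) ,
         Equivalence.from (carry-step {k} {G} {M} {U} α-inv) (subst (λ v → v + _ ≡ _) (sym (toℕ-fromℕ< v<R)) α-inv′) ,
         Equivalence.from (carry-step {k} {G} {M} {Ub} β-inv) (subst (λ w → w + _ ≡ _) (sym (toℕ-fromℕ< w<R)) β-inv′)) ,
    subst (λ o → Covers _ (c′ , o)) (sym (toℕ-fromℕ< o′<1+L)) covers′ ,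
    subst (λ v → v + _ ≡ _) (sym (toℕ-fromℕ< v<R)) α-inv′ ,
    subst (λ w → w + _ ≡ _) (sym (toℕ-fromℕ< w<R)) β-inv′
    where
    c′ = proj₁ (τ (c , toℕ o) (toℕ d))
    o′ = proj₂ (τ (c , toℕ o) (toℕ d))
    covers′ : Covers _ (c′ , o′)
    covers′ = covers-step covers (toℕ<n d)
    o′<1+L : o′ < suc L
    o′<1+L = s≤s (≤-trans (<⇒≤ (proj₁ (proj₂ (proj₂ covers′))))
                          (≤-trans (count≤length a (f c′)) (≤-∑ (λ c → length (f c)) c′)))

  Target : ℕ → ℕ → ℕ → Set
  Target n s t = ∃₂ λ p i → i < length (f (x p)) × n ≡ F p + i × t ≡ W p × s ≡ count b (pref n x)

  target-windows : ∀ {n s t} (zs : List (Fin k × Fin k)) (ds : List (Fin k)) → length ds ≡ length zs →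
                   Target (valFrom n (map proj₁ zs)) (valFrom s (map proj₂ zs)) (valFrom t ds) →
                   Window U t n × Window Ub t s
  target-windows {n} {s} {t} zs ds ∣ds∣≡ (p , i , i< , n≡ , t≡ , s≡) =
    window {U} {i} {n} {val (map proj₁ zs)} {t} {val ds} {r}
      ≤-refl (≤-trans (<⇒≤ i<) (∣f∣≤L (x p))) (val<′ (map proj₁ zs) (length-map proj₁ zs)) (<⇒≤ (val<′ ds ∣ds∣≡))
      (begin
        G * (n * k ^ r + val (map proj₁ zs))            ≡⟨ cong (G *_) (sym (split (map proj₁ zs) (length-map proj₁ zs))) ⟩
        G * valFrom n (map proj₁ zs)                    ≡⟨ cong (G *_) n≡ ⟩
        G * (F p + i)                                   ≡⟨ scaled-length p i ⟩
        U * W p + G * i                                 ≡⟨ cong (λ t → U * t + G * i) (trans (sym t≡) (split ds ∣ds∣≡)) ⟩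
        U * (t * k ^ r + val ds) + G * i                ∎) ,
    window {Ub} {count b (take i (f (x p)))} {s} {val (map proj₂ zs)} {t} {val ds} {r}
      (count≤length b (f a)) (≤-trans (count≤length b (take i (f (x p)))) (≤-trans (length-take-≤ i (f (x p))) (∣f∣≤L (x p))))
      (val<′ (map proj₂ zs) (length-map proj₂ zs)) (<⇒≤ (val<′ ds ∣ds∣≡))
      (begin
        G * (s * k ^ r + val (map proj₂ zs))            ≡⟨ cong (G *_) (sym (split (map proj₂ zs) (length-map proj₂ zs))) ⟩
        G * valFrom s (map proj₂ zs)                    ≡⟨ cong (G *_) s≡ ⟩
        G * count b (pref (valFrom n (map proj₁ zs)) x) ≡⟨ cong (λ n → G * count b (pref n x)) n≡ ⟩
        G * count b (pref (F p + i) x)                  ≡⟨ scaled-count p i (<⇒≤ i<) ⟩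
        Ub * W p + G * count b (take i (f (x p)))
          ≡⟨ cong (λ t → Ub * t + G * count b (take i (f (x p)))) (trans (sym t≡) (split ds ∣ds∣≡)) ⟩
        Ub * (t * k ^ r + val ds) + G * count b (take i (f (x p))) ∎)
    where
    open ≡-Reasoning
    r = length zs
    split : ∀ {n} (ds : List (Fin k)) → length ds ≡ r → valFrom n ds ≡ n * k ^ r + val ds
    split {n} ds ∣ds∣≡r = trans (valFrom-split n ds) (cong (λ l → n * k ^ l + val ds) ∣ds∣≡r)
    val<′ : (ds : List (Fin k)) → length ds ≡ r → val ds < k ^ r
    val<′ ds ∣ds∣≡r = subst (λ l → val ds < k ^ l) ∣ds∣≡r (val< ds)
    ∣f∣≤L : ∀ c → length (f c) ≤ L
    ∣f∣≤L = ≤-∑ (λ c → length (f c))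
    length-take-≤ : ∀ i (w : Word m) → length (take i w) ≤ length w
    length-take-≤ i w = subst (_≤ length w) (sym (length-take i w)) (m⊓n≤n i (length w))

  run-complete : ∀ (zs : List (Fin k × Fin k)) (ds : List (Fin k)) → length ds ≡ length zs →
                 ∀ {n s t q} → Invariant n s t q →
                 Target (valFrom n (map proj₁ zs)) (valFrom s (map proj₂ zs)) (valFrom t ds) →
                 ∃ λ q′ → Run automaton q zs q′ × Final q′
  run-complete [] [] _ {q = q} inv (p , i , i< , n≡ , t≡ , s≡) = q , [] , final-complete p i inv i< n≡ t≡ s≡
  run-complete ((e , e′) ∷ zs) (d ∷ ds) ∣ds∣≡ inv target =
    let α-window , β-window = target-windows zs ds (suc-injective ∣ds∣≡) target
        q′ , step , inv′    = step-complete e e′ d inv α-window β-window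
        q″ , run , final    = run-complete zs ds (suc-injective ∣ds∣≡) inv′ target
    in  q″ , step ∷ run , final

  digit0 : Fin k
  digit0 = fromℕ< (>-nonZero⁻¹ k)

  -- Leading zeros leave room for the digits of t, which may outnumber those of n.
  padding : List (Fin k × Fin k)
  padding = replicate G (digit0 , digit0)

  val-padding : (π : Fin k × Fin k → Fin k) → π (digit0 , digit0) ≡ digit0 →
                ∀ w → val (map π (padding ++ w)) ≡ val (map π w)
  val-padding π π0≡0 = val-padded π (trans (cong toℕ π0≡0) (toℕ-fromℕ< _)) G

  W≤G*n : ∀ p i → W p ≤ G * (F p + i)
  W≤G*n p i = begin
    W p               ≤⟨ m≤n*m (W p) U {{U≢0}} ⟩
    U * W p           ≤⟨ m≤m+n (U * W p) (G * i) ⟩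
    U * W p + G * i   ≡⟨ sym (scaled-length p i) ⟩
    G * (F p + i)     ∎
    where
    open ≤-Reasoning
    U≢0 : NonZero U
    U≢0 = subst NonZero (sym (cong length (proj₂ (proj₁ pr)))) _

  automaton-correct : ∀ w → NAccepts automaton (padding ++ w) ⇔ val (map proj₂ w) ≡ count b (pref (val (map proj₁ w)) x)
  automaton-correct w = mk⇔ sound complete
    where
    val₁ = val-padding proj₁ refl w
    val₂ = val-padding proj₂ refl w
    sound : NAccepts automaton (padding ++ w) → val (map proj₂ w) ≡ count b (pref (val (map proj₁ w)) x)
    sound (q , run , final) =
      subst₂ (λ s n → s ≡ count b (pref n x)) val₂ val₁ (final-sound (proj₂ (run-sound run invariant-start)) final)
    complete : val (map proj₂ w) ≡ count b (pref (val (map proj₁ w)) x) → NAccepts automaton (padding ++ w)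
    complete s≡ =
      let p , i , i< , n≡   = decompose (val (map proj₁ w))
          n<k^∣w∣           = subst (λ l → val (map proj₁ w) < k ^ l) (length-map proj₁ w) (val< (map proj₁ w))
          ds , ∣ds∣≡ , ds≡Wp = digits (G + length w) (W p)
                                 (≤-<-trans (W≤G*n p i) (*-<-^ G (subst (_< k ^ length w) n≡ n<k^∣w∣)))
      in  run-complete (padding ++ w) ds (trans ∣ds∣≡ (sym (trans (length-++ padding) (cong (_+ length w) (length-replicate G)))))
            invariant-start
            (p , i , i< , trans val₁ n≡ , ds≡Wp , trans val₂ (trans s≡ (cong (λ n → count b (pref n x)) (sym val₁))))

lemma18 : {m : ℕ} (f : Morph m) (a : Fin m) (x : ℕ → Fin m) →
    ParikhCollinear f → Prolongable f a → IsFixedPointLimit f a x →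
    (b : Fin m) → Synchronized (eigenvalue f) (λ n → count b (pref n x))
lemma18 f a x pc pr lim b = synchronized-by (guard (restart dfa padding)) λ w →
  ⇔-trans (accepts-guard (restart dfa padding) w)
    (⇔-refl ×-⇔ ⇔-trans (accepts-restart dfa padding w)
                  (⇔-trans (dfa-accepts (padding ++ w)) (automaton-correct w)))
  where
  open Synchronizing f a x pc pr lim b
  open SubsetConstruction automaton using (dfa; dfa-accepts)
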